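{- For every integer $d \geq 1$, the complete bipartite graph $K_{4,d}$ satisfies $\chi'_{st}(K_{4,d}) \leq 20\left\lceil \frac{d}{12} \right\rceil$.
   Context: A star edge coloring of a graph is a proper edge coloring in which there is no path or cycle of length four (i.e., with four edges) whose edges use only two colors. The star chromatic index $\chi'_{st}(G)$ is the minimum number $t$ such that $G$ has a star edge coloring with $t$ colors. -}

module Defs where

open import Level using (Level; suc; _⊔_)
open import Data.Nat using (ℕ; _+_; _≤_)
open import Data.Nat.DivMod using (_/_)
open import Data.Fin using (Fin)
open import Data.Sum using (_⊎_; inj₁; inj₂)
open import Data.Unit using (⊤)
open import Data.Empty using (⊥)
open import Data.Product using (Σ; ∃; ∃-syntax; _×_; _,_)
open import Relation.Nullary using (¬_)
open import Relation.Binary.PropositionalEquality using (_≡_; _≢_)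

record Graph : Set₁ where
  field
    V     : Set
    Adj   : V → V → Set
    sym   : ∀ {u v} → Adj u v → Adj v u
    irrefl : ∀ {v} → ¬ Adj v v
open Graph public

-- An edge colouring with t colours: a colour for every ordered pair of vertices,
-- required to be symmetric on edges (so it is really a function on edges {u,v}).
record EdgeColouring (G : Graph) (t : ℕ) : Set where
  field
    col   : V G → V G → Fin t
    col-sym : ∀ {u v} → Adj G u v → col u v ≡ col v u
open EdgeColouring public

Proper : ∀ {G t} → EdgeColouring G t → Set
Proper {G} c = ∀ {u v w} → Adj G u v → Adj G u w → v ≢ w → col c u v ≢ col c u w

-- A path or cycle of length four (four edges): vertices v0 v1 v2 v3 v4 with
-- consecutive ones adjacent, v0,v1,v2,v3 pairwise distinct and v4 distinct from
-- v1,v2,v3 (v4 = v0 gives a 4-cycle, v4 ≠ v0 a path on five vertices).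
record PathOrCycle4 (G : Graph) : Set where
  field
    v0 v1 v2 v3 v4 : V G
    a01 : Adj G v0 v1
    a12 : Adj G v1 v2
    a23 : Adj G v2 v3
    a34 : Adj G v3 v4
    d01 : v0 ≢ v1
    d02 : v0 ≢ v2
    d03 : v0 ≢ v3
    d12 : v1 ≢ v2
    d13 : v1 ≢ v3
    d23 : v2 ≢ v3
    d14 : v1 ≢ v4
    d24 : v2 ≢ v4
    d34 : v3 ≢ v4
open PathOrCycle4 public

TwoColoured : ∀ {G t} → EdgeColouring G t → PathOrCycle4 G → Set
TwoColoured c P =
  ∃[ a ] ∃[ b ] (In (col c (v0 P) (v1 P)) a b × In (col c (v1 P) (v2 P)) a b
               × In (col c (v2 P) (v3 P)) a b × In (col c (v3 P) (v4 P)) a b)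
  where
  In : ∀ {t} → Fin t → Fin t → Fin t → Set
  In x a b = x ≡ a ⊎ x ≡ b

IsStarEdgeColouring : ∀ {G t} → EdgeColouring G t → Set
IsStarEdgeColouring {G} c = Proper c × (∀ (P : PathOrCycle4 G) → ¬ TwoColoured c P)

StarChromaticIndex≤ : Graph → ℕ → Set
StarChromaticIndex≤ G k = Σ (EdgeColouring G k) IsStarEdgeColouring

K-Adj : ∀ {m n} → Fin m ⊎ Fin n → Fin m ⊎ Fin n → Set
K-Adj (inj₁ _) (inj₂ _) = ⊤
K-Adj (inj₂ _) (inj₁ _) = ⊤
K-Adj (inj₁ _) (inj₁ _) = ⊥
K-Adj (inj₂ _) (inj₂ _) = ⊥

K-sym : ∀ {m n} {u v : Fin m ⊎ Fin n} → K-Adj u v → K-Adj v u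
K-sym {u = inj₁ _} {inj₂ _} p = p
K-sym {u = inj₂ _} {inj₁ _} p = p

K-irrefl : ∀ {m n} {v : Fin m ⊎ Fin n} → ¬ K-Adj v v
K-irrefl {v = inj₁ _} ()
K-irrefl {v = inj₂ _} ()

K : ℕ → ℕ → Graph
K m n = record { V = Fin m ⊎ Fin n ; Adj = K-Adj ; sym = K-sym ; irrefl = K-irrefl }

⌈_/12⌉ : ℕ → ℕ
⌈ d /12⌉ = (d + 11) / 12

-- Split the d right-hand vertices into ⌈d/12⌉ blocks of at most 12 and colour each copy of
-- K_{4,12} with its own palette of 20 colours, using one fixed star edge colouring of K_{4,12}.
-- In a proper colouring a two-coloured path of length four alternates its two colours, so it
-- stays inside one palette, i.e. inside one block, where the fixed colouring excludes it.
module Submission where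

open import Data.Nat using (ℕ; _+_; _*_; _≤_)
open import Data.Nat.DivMod using (_%_; m≡m%n+[m/n]*n; m%n<n)
open import Data.Nat.Properties using (+-comm; +-monoˡ-≤; +-cancelʳ-≤; m<1+n⇒m≤n; module ≤-Reasoning)
open import Data.Fin using (Fin; zero; #_; fromℕ<; inject≤; remQuot; combine)
open import Data.Fin.Properties using (all?; _≟_; inject≤-injective; combine-injective; combine-remQuot)
open import Data.Vec using (Vec; []; _∷_; lookup)
open import Data.Product using (_×_; _,_; uncurry)
open import Data.Product.Properties using (,-injectiveˡ; ,-injectiveʳ)
open import Data.Sum using (_⊎_; inj₁; inj₂)
open import Data.Empty using (⊥)
open import Function using (_∘_; flip)
open import Function.Definitions using (Injective)
open import Relation.Nullary using (Dec; no; ¬?; _→-dec_; _×-dec_)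
open import Relation.Nullary.Decidable using (from-yes; map′)
open import Relation.Binary.PropositionalEquality using (_≡_; _≢_; refl; sym; trans; cong; cong₂; ≢-sym; module ≡-Reasoning)

open import Defs hiding (sym)

private
  variable
    A B B′ C C′ I : Set
    m n k : ℕ

pair-≢⇒≡ : {x y e f g : A} → e ≢ f → g ≢ f →
           e ≡ x ⊎ e ≡ y → f ≡ x ⊎ f ≡ y → g ≡ x ⊎ g ≡ y → g ≡ e
pair-≢⇒≡ e≢f _   (inj₁ e≡x) (inj₁ f≡x) _          with () ← e≢f (trans e≡x (sym f≡x))
pair-≢⇒≡ e≢f _   (inj₂ e≡y) (inj₂ f≡y) _          with () ← e≢f (trans e≡y (sym f≡y))
pair-≢⇒≡ _   _   (inj₁ e≡x) (inj₂ _)   (inj₁ g≡x) = trans g≡x (sym e≡x)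
pair-≢⇒≡ _   g≢f (inj₁ _)   (inj₂ f≡y) (inj₂ g≡y) with () ← g≢f (trans g≡y (sym f≡y))
pair-≢⇒≡ _   _   (inj₂ e≡y) (inj₁ _)   (inj₂ g≡y) = trans g≡y (sym e≡y)
pair-≢⇒≡ _   g≢f (inj₂ _)   (inj₁ f≡x) (inj₁ g≡x) with () ← g≢f (trans g≡x (sym f≡x))

module _ {G : Graph} {t : ℕ} {c : EdgeColouring G t} (proper : Proper c) where

  consecutive-colours-≢ : ∀ {u v w} → Adj G u v → Adj G v w → u ≢ w → col c u v ≢ col c v w
  consecutive-colours-≢ uv vw u≢w eq = proper (Graph.sym G uv) vw u≢w (trans (sym (col-sym c uv)) eq)

  twoColoured⇒alternating : (P : PathOrCycle4 G) → TwoColoured c P →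
    col c (v0 P) (v1 P) ≡ col c (v2 P) (v3 P) × col c (v1 P) (v2 P) ≡ col c (v3 P) (v4 P)
  twoColoured⇒alternating P (_ , _ , c₀₁ , c₁₂ , c₂₃ , c₃₄) =
    sym (pair-≢⇒≡ c₀₁≢c₁₂ (≢-sym c₁₂≢c₂₃) c₀₁ c₁₂ c₂₃) ,
    sym (pair-≢⇒≡ c₁₂≢c₂₃ (≢-sym c₂₃≢c₃₄) c₁₂ c₂₃ c₃₄)
    where
    c₀₁≢c₁₂ : col c (v0 P) (v1 P) ≢ col c (v1 P) (v2 P)
    c₀₁≢c₁₂ = consecutive-colours-≢ (a01 P) (a12 P) (d02 P)
    c₁₂≢c₂₃ : col c (v1 P) (v2 P) ≢ col c (v2 P) (v3 P)
    c₁₂≢c₂₃ = consecutive-colours-≢ (a12 P) (a23 P) (d13 P)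
    c₂₃≢c₃₄ : col c (v2 P) (v3 P) ≢ col c (v3 P) (v4 P)
    c₂₃≢c₃₄ = consecutive-colours-≢ (a23 P) (a34 P) (d24 P)

  alternating-free⇒star :
    (∀ P → col c (v0 P) (v1 P) ≡ col c (v2 P) (v3 P) → col c (v1 P) (v2 P) ≡ col c (v3 P) (v4 P) → ⊥) →
    IsStarEdgeColouring c
  alternating-free⇒star free = proper , λ P → uncurry (free P) ∘ twoColoured⇒alternating P

-- A matrix f : A → B → C colours the edge {a, b} of the complete bipartite graph on A ⊎ B
-- with f a b; a bicoloured path of length four starting in B is then b₀ a b₁ a′ b₂.
NoAlternatingPath : (A → B → C) → Set
NoAlternatingPath f = ∀ a a′ b₀ b₁ b₂ → a ≢ a′ → b₀ ≢ b₁ → b₁ ≢ b₂ →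
                      f a b₀ ≡ f a′ b₁ → f a b₁ ≡ f a′ b₂ → ⊥

record IsStarMatrix (f : A → B → C) : Set where
  constructor isStarMatrix
  field
    rows-injective       : ∀ a → Injective _≡_ _≡_ (f a)
    columns-injective    : ∀ b → Injective _≡_ _≡_ (flip f b)
    no-alternating-path  : NoAlternatingPath f
    no-alternating-pathᵀ : NoAlternatingPath (flip f)
open IsStarMatrix

blockwise : (A → B → C) → A → I × B → I × C
blockwise f a (i , b) = i , f a b

blockwise-isStar : {f : A → B → C} → IsStarMatrix f → IsStarMatrix (blockwise {I = I} f)
blockwise-isStar {f = f} s = isStarMatrix rows columns path pathᵀ
  where
  rows : ∀ a → Injective _≡_ _≡_ (blockwise f a)
  rows a eq = cong₂ _,_ (,-injectiveˡ eq) (rows-injective s a (,-injectiveʳ eq))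

  columns : ∀ ib → Injective _≡_ _≡_ (flip (blockwise f) ib)
  columns (i , b) eq = columns-injective s b (,-injectiveʳ eq)

  path : NoAlternatingPath (blockwise f)
  path a a′ (i , b₀) (_ , b₁) (_ , b₂) a≢a′ ib₀≢ib₁ ib₁≢ib₂ e e′
    with refl ← ,-injectiveˡ e | refl ← ,-injectiveˡ e′ =
    no-alternating-path s a a′ b₀ b₁ b₂ a≢a′ (ib₀≢ib₁ ∘ cong (i ,_)) (ib₁≢ib₂ ∘ cong (i ,_))
      (,-injectiveʳ e) (,-injectiveʳ e′)

  pathᵀ : NoAlternatingPath (flip (blockwise f))
  pathᵀ (i , b) (_ , b′) a₀ a₁ a₂ ib≢ib′ a₀≢a₁ a₁≢a₂ e e′ with refl ← ,-injectiveˡ e =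
    no-alternating-pathᵀ s b b′ a₀ a₁ a₂ (ib≢ib′ ∘ cong (i ,_)) a₀≢a₁ a₁≢a₂
      (,-injectiveʳ e) (,-injectiveʳ e′)

reindex-isStar : {f : A → B → C} {ι : B′ → B} {κ : C → C′} →
                 Injective _≡_ _≡_ ι → Injective _≡_ _≡_ κ →
                 IsStarMatrix f → IsStarMatrix (λ a b → κ (f a (ι b)))
reindex-isStar {ι = ι} ι-inj κ-inj s = isStarMatrix
  (λ a → ι-inj ∘ rows-injective s a ∘ κ-inj)
  (λ b → columns-injective s (ι b) ∘ κ-inj)
  (λ a a′ b₀ b₁ b₂ a≢a′ b₀≢b₁ b₁≢b₂ e e′ →
     no-alternating-path s a a′ (ι b₀) (ι b₁) (ι b₂) a≢a′ (b₀≢b₁ ∘ ι-inj) (b₁≢b₂ ∘ ι-inj) (κ-inj e) (κ-inj e′))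
  (λ b b′ a₀ a₁ a₂ b≢b′ a₀≢a₁ a₁≢a₂ e e′ →
     no-alternating-pathᵀ s (ι b) (ι b′) a₀ a₁ a₂ (b≢b′ ∘ ι-inj) a₀≢a₁ a₁≢a₂ (κ-inj e) (κ-inj e′))

matrixColour : Fin k → (Fin m → Fin n → Fin k) → Fin m ⊎ Fin n → Fin m ⊎ Fin n → Fin k
matrixColour _    f (inj₁ a) (inj₂ b) = f a b
matrixColour _    f (inj₂ b) (inj₁ a) = f a b
matrixColour junk _ _        _        = junk

matrixColouring : Fin k → (Fin m → Fin n → Fin k) → EdgeColouring (K m n) k
matrixColouring junk f = record { col = matrixColour junk f ; col-sym = symmetric }
  where
  symmetric : ∀ {u v} → K-Adj u v → matrixColour junk f u v ≡ matrixColour junk f v u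
  symmetric {inj₁ _} {inj₂ _} _ = refl
  symmetric {inj₂ _} {inj₁ _} _ = refl

isStarMatrix⇒starChromaticIndex≤ : (junk : Fin k) (f : Fin m → Fin n → Fin k) →
                                   IsStarMatrix f → StarChromaticIndex≤ (K m n) k
isStarMatrix⇒starChromaticIndex≤ {k = k} {m = m} {n = n} junk f s =
  matrixColouring junk f ,
  alternating-free⇒star {c = matrixColouring junk f} proper
    (λ P → free (a01 P) (a12 P) (a23 P) (a34 P) (d02 P) (d13 P) (d24 P))
  where
  colour : Fin m ⊎ Fin n → Fin m ⊎ Fin n → Fin k
  colour = matrixColour junk f

  proper : Proper (matrixColouring junk f)
  proper {inj₁ a} {inj₂ _} {inj₂ _} _ _ b≢b′ = b≢b′ ∘ cong inj₂ ∘ rows-injective s a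
  proper {inj₂ b} {inj₁ _} {inj₁ _} _ _ a≢a′ = a≢a′ ∘ cong inj₁ ∘ columns-injective s b
  proper {inj₁ _} {inj₂ _} {inj₁ _} _ ()
  proper {inj₂ _} {inj₁ _} {inj₂ _} _ ()

  free : ∀ {v₀ v₁ v₂ v₃ v₄} → K-Adj v₀ v₁ → K-Adj v₁ v₂ → K-Adj v₂ v₃ → K-Adj v₃ v₄ →
         v₀ ≢ v₂ → v₁ ≢ v₃ → v₂ ≢ v₄ → colour v₀ v₁ ≡ colour v₂ v₃ → colour v₁ v₂ ≡ colour v₃ v₄ → ⊥
  free {inj₂ b₀} {inj₁ a₁} {inj₂ b₂} {inj₁ a₃} {inj₂ b₄} _ _ _ _ v₀≢v₂ v₁≢v₃ v₂≢v₄ =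
    no-alternating-path s a₁ a₃ b₀ b₂ b₄ (v₁≢v₃ ∘ cong inj₁) (v₀≢v₂ ∘ cong inj₂) (v₂≢v₄ ∘ cong inj₂)
  free {inj₁ a₀} {inj₂ b₁} {inj₁ a₂} {inj₂ b₃} {inj₁ a₄} _ _ _ _ v₀≢v₂ v₁≢v₃ v₂≢v₄ =
    no-alternating-pathᵀ s b₁ b₃ a₀ a₂ a₄ (v₁≢v₃ ∘ cong inj₂) (v₀≢v₂ ∘ cong inj₁) (v₂≢v₄ ∘ cong inj₁)
  free {inj₂ _} {inj₁ _} {inj₂ _} {inj₁ _} {inj₁ _} _ _ _ ()
  free {inj₁ _} {inj₂ _} {inj₁ _} {inj₂ _} {inj₂ _} _ _ _ ()
  free {inj₂ _} {inj₁ _} {inj₂ _} {inj₂ _} _ _ ()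
  free {inj₁ _} {inj₂ _} {inj₁ _} {inj₁ _} _ _ ()
  free {inj₂ _} {inj₁ _} {inj₁ _} _ ()
  free {inj₁ _} {inj₂ _} {inj₂ _} _ ()
  free {inj₁ _} {inj₁ _} ()
  free {inj₂ _} {inj₂ _} ()

injective? : (g : Fin n → Fin k) → Dec (Injective _≡_ _≡_ g)
injective? g = map′ (λ inj {i} {j} → inj i j) (λ inj i j → inj {i} {j})
                    (all? λ i → all? λ j → (g i ≟ g j) →-dec (i ≟ j))

noAlternatingPath? : (f : Fin m → Fin n → Fin k) → Dec (NoAlternatingPath f)
noAlternatingPath? f =
  all? λ a → all? λ a′ → all? λ b₀ → all? λ b₁ → all? λ b₂ →
  ¬? (a ≟ a′) →-dec ¬? (b₀ ≟ b₁) →-dec ¬? (b₁ ≟ b₂) →-dec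
  (f a b₀ ≟ f a′ b₁) →-dec (f a b₁ ≟ f a′ b₂) →-dec no λ ()

isStarMatrix? : (f : Fin m → Fin n → Fin k) → Dec (IsStarMatrix f)
isStarMatrix? f =
  map′ (λ (r , c , p , pᵀ) → isStarMatrix r c p pᵀ)
       (λ s → rows-injective s , columns-injective s , no-alternating-path s , no-alternating-pathᵀ s)
       ((all? λ a → injective? (f a)) ×-dec (all? λ b → injective? (flip f b)) ×-dec
        noAlternatingPath? f ×-dec noAlternatingPath? (flip f))

K₄,₁₂-matrix : Fin 4 → Fin 12 → Fin 20
K₄,₁₂-matrix a b = lookup (lookup rows a) b
  where
  rows : Vec (Vec (Fin 20) 12) 4
  rows = (# 17 ∷ # 3 ∷ # 6 ∷ # 12 ∷ # 18 ∷ # 4 ∷ # 7 ∷ # 13 ∷ # 19 ∷ # 2 ∷ # 5 ∷ # 11 ∷ [])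
       ∷ (# 0 ∷ # 1 ∷ # 3 ∷ # 8 ∷ # 12 ∷ # 17 ∷ # 15 ∷ # 14 ∷ # 7 ∷ # 9 ∷ # 13 ∷ # 2 ∷ [])
       ∷ (# 5 ∷ # 10 ∷ # 11 ∷ # 3 ∷ # 0 ∷ # 1 ∷ # 4 ∷ # 9 ∷ # 13 ∷ # 18 ∷ # 16 ∷ # 15 ∷ [])
       ∷ (# 11 ∷ # 19 ∷ # 14 ∷ # 16 ∷ # 6 ∷ # 8 ∷ # 12 ∷ # 4 ∷ # 0 ∷ # 1 ∷ # 2 ∷ # 10 ∷ [])
       ∷ []

K₄,₁₂-matrix-isStar : IsStarMatrix K₄,₁₂-matrix
K₄,₁₂-matrix-isStar = from-yes (isStarMatrix? K₄,₁₂-matrix)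

m≤⌈m/12⌉*12 : ∀ m → m ≤ ⌈ m /12⌉ * 12
m≤⌈m/12⌉*12 m = +-cancelʳ-≤ 11 m (⌈ m /12⌉ * 12) (begin
  m + 11                          ≡⟨ m≡m%n+[m/n]*n (m + 11) 12 ⟩
  (m + 11) % 12 + ⌈ m /12⌉ * 12   ≤⟨ +-monoˡ-≤ (⌈ m /12⌉ * 12) (m<1+n⇒m≤n (m%n<n (m + 11) 12)) ⟩
  11 + ⌈ m /12⌉ * 12              ≡⟨ +-comm 11 (⌈ m /12⌉ * 12) ⟩
  ⌈ m /12⌉ * 12 + 11              ∎)
  where open ≤-Reasoning

remQuot-injective : ∀ m n → Injective _≡_ _≡_ (remQuot {m} n)
remQuot-injective m n {i} {j} eq = begin
  i                                 ≡⟨ combine-remQuot {m} n i ⟨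
  uncurry combine (remQuot {m} n i) ≡⟨ cong (uncurry combine) eq ⟩
  uncurry combine (remQuot {m} n j) ≡⟨ combine-remQuot {m} n j ⟩
  j                                 ∎
  where open ≡-Reasoning

-- 1 ≤ d only supplies a colour for the non-edges; for d = 0 there would be no colours at all.
proposition5 : ∀ (d : ℕ) → 1 ≤ d → StarChromaticIndex≤ (K 4 d) (20 * ⌈ d /12⌉)
proposition5 d 1≤d = isStarMatrix⇒starChromaticIndex≤ (colouring zero (fromℕ< 1≤d)) colouring
  (reindex-isStar block-injective palette-injective (blockwise-isStar K₄,₁₂-matrix-isStar))
  where
  q : ℕ
  q = ⌈ d /12⌉

  block : Fin d → Fin q × Fin 12
  block b = remQuot 12 (inject≤ b (m≤⌈m/12⌉*12 d))

  block-injective : Injective _≡_ _≡_ block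
  block-injective = inject≤-injective _ _ _ _ ∘ remQuot-injective q 12

  palette : Fin q × Fin 20 → Fin (20 * q)
  palette (i , c) = combine c i

  palette-injective : Injective _≡_ _≡_ palette
  palette-injective {i , c} {j , c′} eq = let c≡c′ , i≡j = combine-injective c i c′ j eq in cong₂ _,_ i≡j c≡c′

  colouring : Fin 4 → Fin d → Fin (20 * q)
  colouring a b = palette (blockwise K₄,₁₂-matrix a (block b))
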